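{- Let $\mathcal M\subset\mathbb Z^n$ be a minimal subgraph. Then every connected component of (the induced subgraph on) $\mathcal M$ is also minimal.
   Context: $\mathbb Z^n$ is the integer lattice graph ($x\sim y$ iff $|x-y|=1$). For $\Omega\subset\mathbb Z^n$: $\tau\Omega=\{z\notin\Omega:\exists w\in\Omega,z\sim w\}$, $\overline\Omega=\Omega\cup\tau\Omega$, $E_\Omega$ = edges $\{x,y\}$ with $x\in\Omega,y\in\overline\Omega$, $\partial K$ = edges with exactly one endpoint in $K$. A proper nonempty $\mathcal M\subset\mathbb Z^n$ is minimal if for every finite $U$ and every $\hat K\subset\overline U$ with $\hat K\cap\tau U=\mathcal M\cap\tau U$, $|\partial\mathcal M\cap E_U|\le|\partial\hat K\cap E_U|$. -}

module Defs where

open import Data.Nat using (ℕ; _≤_)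
open import Data.Integer as ℤ using (ℤ)
open import Data.Fin as Fin using (Fin)
open import Data.Bool using (Bool; true; false; _xor_)
import Data.Bool.Properties as BoolP
open import Data.Vec using (Vec; updateAt)
import Data.Vec.Properties as VecP
import Data.Product.Properties as ProdP
open import Data.Product using (Σ; _×_; _,_; ∃; ∃-syntax)
open import Data.Sum using (_⊎_)
open import Data.List using (List; []; _∷_; length; filter; deduplicate; concatMap; allFin)
open import Data.List.Membership.Propositional using (_∈_)
open import Relation.Binary.PropositionalEquality using (_≡_)
open import Relation.Binary.Definitions using (DecidableEquality)
open import Relation.Nullary using (¬_)

Point : ℕ → Set
Point n = Vec ℤ n

up : ∀ {n} → Point n → Fin n → Point n
up x i = updateAt x i ℤ.suc

down : ∀ {n} → Point n → Fin n → Point n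
down x i = updateAt x i ℤ.pred

_∼_ : ∀ {n} → Point n → Point n → Set
x ∼ y = ∃[ i ] (y ≡ up x i ⊎ y ≡ down x i)

Subset : ℕ → Set
Subset n = Point n → Bool

_∈ˢ_ : ∀ {n} → Point n → Subset n → Set
x ∈ˢ K = K x ≡ true

_⊆ˢ_ : ∀ {n} → Subset n → Subset n → Set
A ⊆ˢ B = ∀ x → x ∈ˢ A → x ∈ˢ B

-- Finite sets U ⊂ ℤⁿ are given by a list enumerating them.
-- τU: outer vertex boundary.
_∈τ_ : ∀ {n} → Point n → List (Point n) → Set
z ∈τ U = ¬ (z ∈ U) × (∃[ w ] (w ∈ U × z ∼ w))

_∈cl_ : ∀ {n} → Point n → List (Point n) → Set
z ∈cl U = z ∈ U ⊎ z ∈τ U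

-- Edges of ℤⁿ: the unordered edge {x, x + e_i} is represented uniquely by (x , i).
Edge : ℕ → Set
Edge n = Point n × Fin n

_≟P_ : ∀ {n} → DecidableEquality (Point n)
_≟P_ = VecP.≡-dec ℤ._≟_

_≟E_ : ∀ {n} → DecidableEquality (Edge n)
_≟E_ = ProdP.≡-dec _≟P_ Fin._≟_

-- E_U: all edges {x,y} with x ∈ U (y ∈ Ū automatically), without repetition.
edgesU : ∀ {n} → List (Point n) → List (Edge n)
edgesU {n} U = deduplicate _≟E_
  (concatMap (λ u → concatMap (λ i → (u , i) ∷ (down u i , i) ∷ []) (allFin n)) U)

_∈∂_ : ∀ {n} → Edge n → Subset n → Set
(x , i) ∈∂ K = (K x xor K (up x i)) ≡ true

bdryCount : ∀ {n} → List (Point n) → Subset n → ℕ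
bdryCount U K = length (filter (λ { (x , i) → (K x xor K (up x i)) BoolP.≟ true }) (edgesU U))

Minimal : ∀ {n} → Subset n → Set
Minimal {n} M =
  (∃[ x ] x ∈ˢ M) × (∃[ x ] M x ≡ false) ×
  (∀ (U : List (Point n)) (K : Subset n) →
     (∀ x → x ∈ˢ K → x ∈cl U) →
     (∀ z → z ∈τ U → K z ≡ M z) →
     bdryCount U M ≤ bdryCount U K)

data PathIn {n} (C : Subset n) : Point n → Point n → Set where
  here : ∀ {x} → x ∈ˢ C → PathIn C x x
  step : ∀ {x y z} → x ∈ˢ C → x ∼ y → PathIn C y z → PathIn C x z

IsComponent : ∀ {n} → Subset n → Subset n → Set
IsComponent C M =
  C ⊆ˢ M × (∃[ x ] x ∈ˢ C) ×
  (∀ x y → x ∈ˢ C → y ∈ˢ C → PathIn C x y) ×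
  (∀ x y → x ∈ˢ C → y ∈ˢ M → x ∼ y → y ∈ˢ C)

module Submission where

-- Because C is closed under adjacency inside M, no vertex or edge joins C to D = M ∖ C, so on
-- E_U the boundary of M splits exactly as |∂C| + |∂D|.  A competitor K for C on U gives the
-- competitor K ∪ (D ∩ Ū) for M, whose boundary on E_U is at most |∂K| + |∂D|; minimality of M
-- and cancelling |∂D| yield |∂C| ≤ |∂K|.

open import Defs

open import Data.Bool using (Bool; true; false; _∧_; _∨_; not; _xor_)
import Data.Bool.Properties as Bool
open import Data.Empty using (⊥-elim)
open import Data.Fin using (Fin)
import Data.Integer.Properties as ℤ
open import Data.List using (List; []; _∷_; length; filter; allFin)
open import Data.List.Membership.Propositional using (_∈_; find; lose)
open import Data.List.Membership.Propositional.Properties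
  using (∈-allFin; ∈-concatMap⁻; ∈-deduplicate⁻)
import Data.List.Membership.DecPropositional as DecMembership
open import Data.List.Relation.Unary.Any using (Any; here; there; any?)
open import Data.Nat using (ℕ; suc; _+_; _≤_; z≤n; s≤s)
import Data.Nat.Properties as Nat
open import Algebra.Properties.CommutativeSemigroup Nat.+-commutativeSemigroup
  using (interchange)
open import Data.Product using (_×_; _,_; ∃-syntax; uncurry)
open import Data.Sum using (_⊎_; inj₁; inj₂)
open import Function using (_∘_)
import Data.Vec.Properties as Vec
open import Relation.Binary.PropositionalEquality
open import Relation.Nullary using (Dec; yes; no; does)
open import Relation.Nullary.Decidable using (dec-true; _⊎-dec_)
import Relation.Nullary.Decidable as Dec

variable
  n : ℕ
  A : Set

down-up : (x : Point n) (i : Fin n) → down (up x i) i ≡ x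
down-up x i = trans (Vec.updateAt-updateAt i x) (Vec.updateAt-id-local i x (ℤ.pred-suc _))

up-down : (x : Point n) (i : Fin n) → up (down x i) i ≡ x
up-down x i = trans (Vec.updateAt-updateAt i x) (Vec.updateAt-id-local i x (ℤ.suc-pred _))

∼-up : (x : Point n) (i : Fin n) → x ∼ up x i
∼-up x i = i , inj₁ refl

up-∼ : (x : Point n) (i : Fin n) → up x i ∼ x
up-∼ x i = i , inj₂ (sym (down-up x i))

down-∼ : (x : Point n) (i : Fin n) → down x i ∼ x
down-∼ x i = i , inj₁ (sym (up-down x i))

module _ (U : List (Point n)) where
  open DecMembership (_≟P_ {n}) using (_∈?_)

  ∼-∈cl : ∀ {x w} → x ∼ w → w ∈ U → x ∈cl U
  ∼-∈cl {x} x∼w w∈U with x ∈? U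
  ... | yes x∈U = inj₁ x∈U
  ... | no x∉U = inj₂ (x∉U , _ , w∈U , x∼w)

  ∈cl? : ∀ x → Dec (x ∈cl U)
  ∈cl? x with x ∈? U
  ... | yes x∈U = yes (inj₁ x∈U)
  ... | no x∉U = Dec.map′ witness index (any? (λ i → up x i ∈? U ⊎-dec down x i ∈? U) (allFin n))
    where
    witness : Any (λ i → up x i ∈ U ⊎ down x i ∈ U) (allFin n) → x ∈cl U
    witness a with find a
    ... | i , _ , inj₁ p = inj₂ (x∉U , _ , p , i , inj₁ refl)
    ... | i , _ , inj₂ p = inj₂ (x∉U , _ , p , i , inj₂ refl)
    index : x ∈cl U → Any (λ i → up x i ∈ U ⊎ down x i ∈ U) (allFin n)
    index (inj₁ x∈U) = ⊥-elim (x∉U x∈U)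
    index (inj₂ (_ , _ , w∈U , i , inj₁ refl)) = lose (∈-allFin i) (inj₁ w∈U)
    index (inj₂ (_ , _ , w∈U , i , inj₂ refl)) = lose (∈-allFin i) (inj₂ w∈U)

  cl : Subset n
  cl x = does (∈cl? x)

  cl-sound : ∀ x → x ∈ˢ cl → x ∈cl U
  cl-sound x h with ∈cl? x
  ... | yes x∈cl = x∈cl

  cl-complete : ∀ x → x ∈cl U → x ∈ˢ cl
  cl-complete x = dec-true (∈cl? x)

  edgesU-∈cl : ∀ {x i} → (x , i) ∈ edgesU U → x ∈cl U × up x i ∈cl U
  edgesU-∈cl e∈E with find (∈-concatMap⁻ _ (∈-deduplicate⁻ _≟E_ _ e∈E))
  ... | u , u∈U , e∈Eᵤ with find (∈-concatMap⁻ (λ j → (u , j) ∷ (down u j , j) ∷ []) {allFin n} e∈Eᵤ)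
  ...   | j , _ , here refl = inj₁ u∈U , ∼-∈cl (up-∼ u j) u∈U
  ...   | j , _ , there (here refl) =
          ∼-∈cl (down-∼ u j) u∈U , subst (_∈cl U) (sym (up-down u j)) (inj₁ u∈U)

toℕ : Bool → ℕ
toℕ false = 0
toℕ true  = 1

count : (A → Bool) → List A → ℕ
count p []       = 0
count p (a ∷ as) = toℕ (p a) + count p as

length-filter-≡true : (p : A → Bool) (as : List A) →
  length (filter (λ a → p a Bool.≟ true) as) ≡ count p as
length-filter-≡true p [] = refl
length-filter-≡true p (a ∷ as) with p a
... | true  = cong suc (length-filter-≡true p as)
... | false = length-filter-≡true p as

count-cong : {p q : A → Bool} (as : List A) → (∀ {a} → a ∈ as → p a ≡ q a) →
  count p as ≡ count q as
count-cong []       eq = refl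
count-cong (a ∷ as) eq = cong₂ _+_ (cong toℕ (eq (here refl))) (count-cong as (eq ∘ there))

count-≤-+ : {p q r : A → Bool} (as : List A) →
  (∀ a → toℕ (r a) ≤ toℕ (p a) + toℕ (q a)) → count r as ≤ count p as + count q as
count-≤-+ []       le = z≤n
count-≤-+ {p = p} {q} (a ∷ as) le = Nat.≤-trans (Nat.+-mono-≤ (le a) (count-≤-+ as le))
  (Nat.≤-reflexive (interchange (toℕ (p a)) (toℕ (q a)) (count p as) (count q as)))

count-+ : {p q r : A → Bool} (as : List A) →
  (∀ a → toℕ (r a) ≡ toℕ (p a) + toℕ (q a)) → count r as ≡ count p as + count q as
count-+ []       eq = refl
count-+ {p = p} {q} (a ∷ as) eq = trans (cong₂ _+_ (eq a) (count-+ as eq))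
  (interchange (toℕ (p a)) (toℕ (q a)) (count p as) (count q as))

toℕ-xor-∨-≤ : ∀ a b c d → toℕ ((a ∨ c) xor (b ∨ d)) ≤ toℕ (a xor b) + toℕ (c xor d)
toℕ-xor-∨-≤ true  true  c     d     = z≤n
toℕ-xor-∨-≤ true  false c     true  = z≤n
toℕ-xor-∨-≤ true  false c     false = s≤s z≤n
toℕ-xor-∨-≤ false true  true  d     = z≤n
toℕ-xor-∨-≤ false true  false d     = s≤s z≤n
toℕ-xor-∨-≤ false false c     d     = Nat.≤-refl

toℕ-xor-∨ : ∀ a b c d → a ∧ c ≡ false → b ∧ d ≡ false → a ∧ d ≡ false → b ∧ c ≡ false →
  toℕ ((a ∨ c) xor (b ∨ d)) ≡ toℕ (a xor b) + toℕ (c xor d)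
toℕ-xor-∨ true  true  .false .false refl refl _    _    = refl
toℕ-xor-∨ true  false .false .false refl _    refl _    = refl
toℕ-xor-∨ false true  .false .false _    refl _    refl = refl
toℕ-xor-∨ false false c      d      _    _    _    _    = refl

_∪ˢ_ _∩ˢ_ _∖ˢ_ : Subset n → Subset n → Subset n
(A ∪ˢ B) x = A x ∨ B x
(A ∩ˢ B) x = A x ∧ B x
(A ∖ˢ B) x = A x ∧ not (B x)

⊆ˢ⇒≡∪∖ : {C M : Subset n} → C ⊆ˢ M → ∀ x → M x ≡ (C ∪ˢ (M ∖ˢ C)) x
⊆ˢ⇒≡∪∖ {C = C} {M} C⊆M x with C x in Cx
... | true  = C⊆M x Cx
... | false = sym (Bool.∧-identityʳ (M x))

Separated : Subset n → Subset n → Set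
Separated A B = ∀ {x y} → x ≡ y ⊎ x ∼ y → A x ∧ B y ≡ false

AdjacencyClosedIn : Subset n → Subset n → Set
AdjacencyClosedIn C M = ∀ x y → x ∈ˢ C → y ∈ˢ M → x ∼ y → y ∈ˢ C

≡⊎∼-closed : {C M : Subset n} → AdjacencyClosedIn C M → ∀ {x y} → x ≡ y ⊎ x ∼ y →
  x ∈ˢ C → y ∈ˢ M → y ∈ˢ C
≡⊎∼-closed closed (inj₁ refl) Cx My = Cx
≡⊎∼-closed closed (inj₂ x∼y)  Cx My = closed _ _ Cx My x∼y

closed⇒separated : {C M : Subset n} → AdjacencyClosedIn C M → Separated C (M ∖ˢ C)
closed⇒separated {C = C} {M} closed {x} {y} x≈y with C x in Cx | M y in My
... | false | _     = refl
... | true  | false = refl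
... | true  | true  rewrite ≡⊎∼-closed closed x≈y Cx My = refl

boundary : Subset n → Edge n → Bool
boundary K (x , i) = K x xor K (up x i)

bdryCount-count : (U : List (Point n)) (K : Subset n) → bdryCount U K ≡ count (boundary K) (edgesU U)
bdryCount-count U K = length-filter-≡true (boundary K) (edgesU U)

bdryCount-local : (U : List (Point n)) {A B : Subset n} → (∀ x → x ∈cl U → A x ≡ B x) →
  bdryCount U A ≡ bdryCount U B
bdryCount-local U {A} {B} A≈B = begin
  bdryCount U A                     ≡⟨ bdryCount-count U A ⟩
  count (boundary A) (edgesU U)     ≡⟨ count-cong (edgesU U) agree ⟩
  count (boundary B) (edgesU U)     ≡⟨ bdryCount-count U B ⟨
  bdryCount U B                     ∎
  where
  open ≡-Reasoning
  agree : ∀ {e} → e ∈ edgesU U → boundary A e ≡ boundary B e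
  agree {x , i} e∈E with edgesU-∈cl U e∈E
  ... | x∈Ū , y∈Ū = cong₂ _xor_ (A≈B x x∈Ū) (A≈B (up x i) y∈Ū)

bdryCount-∪-≤ : (U : List (Point n)) (A B : Subset n) →
  bdryCount U (A ∪ˢ B) ≤ bdryCount U A + bdryCount U B
bdryCount-∪-≤ U A B
  rewrite bdryCount-count U (A ∪ˢ B) | bdryCount-count U A | bdryCount-count U B
  = count-≤-+ (edgesU U) λ (x , i) → toℕ-xor-∨-≤ (A x) (A (up x i)) (B x) (B (up x i))

bdryCount-∪-separated : (U : List (Point n)) (A B : Subset n) → Separated A B →
  bdryCount U (A ∪ˢ B) ≡ bdryCount U A + bdryCount U B
bdryCount-∪-separated U A B sep
  rewrite bdryCount-count U (A ∪ˢ B) | bdryCount-count U A | bdryCount-count U B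
  = count-+ (edgesU U) λ (x , i) → toℕ-xor-∨ (A x) (A (up x i)) (B x) (B (up x i))
      (sep (inj₁ refl)) (sep (inj₁ refl)) (sep (inj₂ (∼-up x i))) (sep (inj₂ (up-∼ x i)))

Competitor : List (Point n) → Subset n → Subset n → Set
Competitor U M K = (∀ x → x ∈ˢ K → x ∈cl U) × (∀ z → z ∈τ U → K z ≡ M z)

∩ˢ-cl : (U : List (Point n)) (A : Subset n) → ∀ x → x ∈cl U → (A ∩ˢ cl U) x ≡ A x
∩ˢ-cl U A x x∈Ū rewrite cl-complete U x x∈Ū = Bool.∧-identityʳ (A x)

∪∖-competitor : (U : List (Point n)) {C M K : Subset n} → C ⊆ˢ M → Competitor U C K →
  Competitor U M (K ∪ˢ ((M ∖ˢ C) ∩ˢ cl U))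
∪∖-competitor U {C} {M} {K} C⊆M (K⊆Ū , K≡C) = ⊆Ū , ≡M
  where
  ⊆Ū : ∀ x → (K ∪ˢ ((M ∖ˢ C) ∩ˢ cl U)) x ≡ true → x ∈cl U
  ⊆Ū x h with K x in Kx
  ... | true = K⊆Ū x Kx
  ... | false with (M ∖ˢ C) x
  ...   | true = cl-sound U x h
  ≡M : ∀ z → z ∈τ U → (K ∪ˢ ((M ∖ˢ C) ∩ˢ cl U)) z ≡ M z
  ≡M z z∈τ rewrite K≡C z z∈τ | ∩ˢ-cl U (M ∖ˢ C) z (inj₂ z∈τ) = sym (⊆ˢ⇒≡∪∖ C⊆M z)

bdryCount-≤-competitor : {M C : Subset n} → Minimal M → C ⊆ˢ M → AdjacencyClosedIn C M →
  (U : List (Point n)) (K : Subset n) → Competitor U C K → bdryCount U C ≤ bdryCount U K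
bdryCount-≤-competitor {n = n} {M = M} {C} (_ , _ , minM) C⊆M closed U K K-competitor =
  Nat.+-cancelʳ-≤ (bdryCount U D) (bdryCount U C) (bdryCount U K) (begin
    bdryCount U C + bdryCount U D  ≡⟨ bdryCount-∪-separated U C D (closed⇒separated closed) ⟨
    bdryCount U (C ∪ˢ D)           ≡⟨ bdryCount-local U (λ x _ → ⊆ˢ⇒≡∪∖ C⊆M x) ⟨
    bdryCount U M                  ≤⟨ uncurry (minM U K′) K′-competitor ⟩
    bdryCount U K′                 ≡⟨ bdryCount-local U (λ x x∈Ū → cong (K x ∨_) (∩ˢ-cl U D x x∈Ū)) ⟩
    bdryCount U (K ∪ˢ D)           ≤⟨ bdryCount-∪-≤ U K D ⟩
    bdryCount U K + bdryCount U D  ∎)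
  where
  open Nat.≤-Reasoning
  D K′ : Subset n
  D  = M ∖ˢ C
  K′ = K ∪ˢ (D ∩ˢ cl U)
  K′-competitor : Competitor U M K′
  K′-competitor = ∪∖-competitor U C⊆M K-competitor

minimal-closed-part : {M C : Subset n} → Minimal M → C ⊆ˢ M → ∃[ x ] x ∈ˢ C →
  AdjacencyClosedIn C M → Minimal C
minimal-closed-part minM@(_ , (x , Mx) , _) C⊆M C≠∅ closed =
  C≠∅ , (x , Bool.¬-not (λ Cx → Bool.not-¬ Mx (C⊆M x Cx))) ,
  λ U K K⊆Ū K≡C → bdryCount-≤-competitor minM C⊆M closed U K (K⊆Ū , K≡C)

proposition4p1 : ∀ {n} (M C : Subset n) → Minimal M → IsComponent C M → Minimal C
proposition4p1 M C minM (C⊆M , C≠∅ , _ , closed) = minimal-closed-part minM C⊆M C≠∅ closed
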